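{- For every connected graph $H$ (with at least three nodes, of constant size) and every $r \geq r_H$, where $r_H = \widetilde{\operatorname{diam}}(H) - 1$, the $r$-round bandwidth complexity of $\textsc{MemList}(H)$ under any single type of topological change (node insertions, node deletions, edge insertions, or edge deletions) is $O(n^2/r)$.
   Context: Node-edge distance: $\operatorname{dist}_G(u,\{v,w\}) = 1 + \min\{\operatorname{dist}_G(u,v), \operatorname{dist}_G(u,w)\}$; $\widetilde{\operatorname{diam}}(G) = \max_{u \in V(G)} \max_{e \in E(G)} \operatorname{dist}_G(u,e)$. Dynamic network model: a sequence of graphs $G^0, G^1, \ldots$ on $n$ nodes, each obtained from the previous by at most one topological change of the allowed type; nodes have distinct IDs from $[n]$, know their neighbors' IDs and initially the whole of $G^0$; communication is synchronous, each round the change happens first, then each node sends a $B$-bit message to each neighbor; nodes detect changes only via their neighbor lists; algorithms are deterministic. An $r$-round algorithm works under the promise that each change at round $i$ is followed by $r-1$ change-free rounds and must output correctly for $G^i$ by the end of round $i+r-1$. The $r$-round bandwidth complexity is the minimum such $B$. $\textsc{MemList}(H)$: each node $v$ lists all subgraphs isomorphic to $H$ containing $v$. -}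

module Defs where

open import Level using (0ℓ)
open import Data.Nat using (ℕ; zero; suc; _+_; _*_; _∸_; _≤_; _<_)
open import Data.Fin using (Fin)
open import Data.Fin.Subset using (Subset; _∈_; _∉_)
import Data.Fin.Subset.Properties as SP
open import Data.Vec using (Vec; lookup)
open import Data.Bool using (Bool; if_then_else_)
open import Data.Maybe using (Maybe; just; nothing)
open import Data.List using (List)
import Data.List.Membership.Propositional as L
open import Data.Product using (Σ; ∃; ∃-syntax; _×_; _,_)
open import Data.Sum using (_⊎_)
open import Relation.Nullary using (¬_; does)
open import Relation.Binary.PropositionalEquality using (_≡_; _≢_)
open import Function.Bundles using (_⇔_)
open import Function.Definitions using (Injective)
open import Data.Nat using (_⊔_) renaming (_⊓_ to min)

record SimpleGraph (k : ℕ) : Set where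
  field
    adj    : Vec (Subset k) k
    sym    : ∀ u w → w ∈ lookup adj u → u ∈ lookup adj w
    irrefl : ∀ u → u ∉ lookup adj u

SAdj : ∀ {k} → SimpleGraph k → Fin k → Fin k → Set
SAdj H u w = w ∈ lookup (SimpleGraph.adj H) u

data Walk {k : ℕ} (H : SimpleGraph k) : Fin k → Fin k → ℕ → Set where
  [] : ∀ {u} → Walk H u u 0
  _∷_ : ∀ {u w v l} → SAdj H u w → Walk H w v l → Walk H u v (suc l)

Connected : ∀ {k} → SimpleGraph k → Set
Connected H = ∀ a b → ∃[ l ] Walk H a b l

Dist : ∀ {k} → SimpleGraph k → Fin k → Fin k → ℕ → Set
Dist H u v d = Walk H u v d × (∀ d′ → d′ < d → ¬ Walk H u v d′)

NodeEdgeDist : ∀ {k} → SimpleGraph k → Fin k → Fin k → Fin k → ℕ → Set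
NodeEdgeDist H u v w d =
  SAdj H v w × ∃[ dv ] ∃[ dw ] (Dist H u v dv × Dist H u w dw × d ≡ suc (min dv dw))

TildeDiam : ∀ {k} → SimpleGraph k → ℕ → Set
TildeDiam H D =
  (∀ u v w d → NodeEdgeDist H u v w d → d ≤ D) ×
  ∃[ u ] ∃[ v ] ∃[ w ] NodeEdgeDist H u v w D

-- Dynamic-network graphs on the ID space Fin n: a set of present nodes
-- and a symmetric irreflexive adjacency among present nodes.

record DGraph (n : ℕ) : Set where
  field
    present : Subset n
    adj     : Vec (Subset n) n
    sym     : ∀ u w → w ∈ lookup adj u → u ∈ lookup adj w
    irrefl  : ∀ u → u ∉ lookup adj u
    closed  : ∀ u w → w ∈ lookup adj u → u ∈ present

Adj : ∀ {n} → DGraph n → Fin n → Fin n → Set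
Adj G u w = w ∈ lookup (DGraph.adj G) u

Present : ∀ {n} → DGraph n → Fin n → Set
Present G u = u ∈ DGraph.present G

nbrs : ∀ {n} → DGraph n → Fin n → Subset n
nbrs G v = lookup (DGraph.adj G) v

Same : ∀ {n} → DGraph n → DGraph n → Set
Same G G′ = DGraph.present G ≡ DGraph.present G′ × DGraph.adj G ≡ DGraph.adj G′

data ChangeType : Set where
  nodeInsertion nodeDeletion edgeInsertion edgeDeletion : ChangeType

IsPair : ∀ {n} → Fin n → Fin n → Fin n → Fin n → Set
IsPair a b u w = (a ≡ u × b ≡ w) ⊎ (a ≡ w × b ≡ u)

OneChange : ∀ {n} → ChangeType → DGraph n → DGraph n → Set
OneChange edgeInsertion G G′ = ∃[ u ] ∃[ w ]
  (u ≢ w × Present G u × Present G w × ¬ Adj G u w ×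
   DGraph.present G′ ≡ DGraph.present G ×
   (∀ a b → Adj G′ a b ⇔ (Adj G a b ⊎ IsPair a b u w)))
OneChange edgeDeletion G G′ = ∃[ u ] ∃[ w ]
  (Adj G u w ×
   DGraph.present G′ ≡ DGraph.present G ×
   (∀ a b → Adj G′ a b ⇔ (Adj G a b × ¬ IsPair a b u w)))
OneChange nodeInsertion G G′ = ∃[ v ]
  (¬ Present G v ×
   (∀ a → Present G′ a ⇔ (Present G a ⊎ a ≡ v)) ×
   (∀ a b → a ≢ v → b ≢ v → (Adj G′ a b ⇔ Adj G a b)))
OneChange nodeDeletion G G′ = ∃[ v ]
  (Present G v ×
   (∀ a → Present G′ a ⇔ (Present G a × a ≢ v)) ×
   (∀ a b → Adj G′ a b ⇔ (Adj G a b × a ≢ v × b ≢ v)))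

ValidDynamic : ∀ {n} → ChangeType → (ℕ → DGraph n) → Set
ValidDynamic τ Gs = ∀ t → Same (Gs t) (Gs (suc t)) ⊎ OneChange τ (Gs t) (Gs (suc t))

Promise : ∀ {n} → ℕ → (ℕ → DGraph n) → Set
Promise r Gs = ∀ i → ¬ Same (Gs i) (Gs (suc i)) →
  ∀ d → suc d < r → Same (Gs (suc i + d)) (Gs (suc (suc i + d)))

-- no change happened in rounds t-r+2, …, t (so the last change, if any,
-- happened at round ≤ t-r+1 and the output at the end of round t must be correct)
Settled : ∀ {n} → ℕ → (ℕ → DGraph n) → ℕ → Set
Settled r Gs t = ∀ d → suc d < r → d < t → Same (Gs (t ∸ suc d)) (Gs (t ∸ d))

record Sub (n : ℕ) : Set where
  constructor sub
  field
    verts : Subset n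
    edges : Vec (Subset n) n

SEdge : ∀ {n} → Sub n → Fin n → Fin n → Set
SEdge S a b = b ∈ lookup (Sub.edges S) a

IsSubgraphOf : ∀ {n} → Sub n → DGraph n → Set
IsSubgraphOf S G =
  (∀ a → a ∈ Sub.verts S → Present G a) ×
  (∀ a b → SEdge S a b → SEdge S b a) ×
  (∀ a → ¬ SEdge S a a) ×
  (∀ a b → SEdge S a b → a ∈ Sub.verts S × b ∈ Sub.verts S × Adj G a b)

IsoTo : ∀ {n k} → Sub n → SimpleGraph k → Set
IsoTo {n} {k} S H = Σ (Fin k → Fin n) λ f →
  Injective _≡_ _≡_ f ×
  (∀ a → f a ∈ Sub.verts S) ×
  (∀ x → x ∈ Sub.verts S → ∃[ a ] f a ≡ x) ×
  (∀ a b → SAdj H a b ⇔ SEdge S (f a) (f b))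

MemListCorrect : ∀ {n k} → SimpleGraph k → DGraph n → Fin n → List (Sub n) → Set
MemListCorrect H G v out = ∀ S →
  (S L.∈ out) ⇔ (IsSubgraphOf S G × v ∈ Sub.verts S × IsoTo S H)

record Algorithm (n B : ℕ) : Set₁ where
  field
    State : Set
    -- own ID and the initial graph G⁰
    init  : Fin n → DGraph n → State
    -- message to a neighbour, given state and current neighbour list
    send  : State → Subset n → Fin n → Vec Bool B
    -- new state from old state, current neighbour list and received messages
    recv  : State → Subset n → (Fin n → Maybe (Vec Bool B)) → State
    out   : State → List (Sub n)

module _ {n B : ℕ} (A : Algorithm n B) (Gs : ℕ → DGraph n) where
  open Algorithm A
  -- state of each node at the end of round t (t = 0: initial state)
  state : ℕ → Fin n → State
  state zero v = init v (Gs 0)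
  state (suc t) v =
    recv (state t v) (nbrs (Gs (suc t)) v)
      (λ w → if does (w SP.∈? nbrs (Gs (suc t)) v)
             then just (send (state t w) (nbrs (Gs (suc t)) w) v)
             else nothing)

SolvesMemList : ∀ {n k B} → SimpleGraph k → ChangeType → ℕ → Algorithm n B → Set
SolvesMemList H τ r A = ∀ Gs → ValidDynamic τ Gs → Promise r Gs →
  ∀ t → Settled r Gs t → ∀ v →
  MemListCorrect H (Gs t) v (Algorithm.out A (state A Gs t v))

-- Every node v keeps, for each node x, a claimed distance from v to x together with a claimed
-- neighbourhood of x, and improves these claims Bellman–Ford style from the claims of its neighbours:
-- on a static graph, j relaxations give every node the exact neighbourhoods of all nodes within
-- distance j. The claims of a node take n (D + 1 + n) bits, where D = diam~(H), so they are streamed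
-- to the neighbours over epochs of m = ⌊(r + 1)/D⌋ rounds with B = 1 + ⌊n (D + 1 + n)/m⌋ = O(n²/r)
-- bits per round, and a relaxation happens at the end of each epoch. Since D m ≤ r + 1, the rounds
-- after the last change contain D − 1 complete epochs, after which every node knows the neighbourhoods
-- of all nodes at distance < D. That suffices to list the copies of H through v: every edge of such a
-- copy is at node-edge distance at most D from v, hence has an endpoint at distance less than D.

module Submission where

open import Defs
open import Data.Nat
  using (ℕ; zero; suc; _+_; _*_; _∸_; _/_; _≤_; _<_; _≤?_; _<?_; _≡ᵇ_; z≤n; s≤s; s≤s⁻¹; NonZero)
open import Data.Nat.Properties
  using (≤-refl; ≤-trans; <-trans; ≤-<-trans; <-≤-trans; <-irrefl; <⇒≤; <⇒≢; ≰⇒>; ≤∧≢⇒<; n≤1+n; n<1+n;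
         m≤m+n; m≤n+m; m≤m*n; +-comm; +-identityʳ; *-comm; *-distribˡ-+; *-distribʳ-+;
         +-mono-≤; +-monoˡ-≤; +-monoʳ-≤; +-monoˡ-<; *-monoˡ-≤; *-monoʳ-≤;
         m∸[m∸n]≡n; m+[n∸m]≡n; m∸n≤m; ∸-monoˡ-<; m+n∸n≡m; m≤n⇒m⊓n≡m; m≥n⇒m⊓n≡n;
         ≡ᵇ⇒≡; ≡⇒≡ᵇ; anyUpTo?; module ≤-Reasoning)
  renaming (_≟_ to _≟ℕ_)
open import Data.Nat.DivMod using (_%_; m%n<n; m≡m%n+[m/n]*n; [m+kn]%n≡m%n; m<n⇒m%n≡m; m/n*n≤m; m<n*o⇒m/o<n)
open import Data.Nat.Induction using (<-rec)
open import Data.Nat.Solver using (module +-*-Solver)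
open import Data.Fin using (Fin; zero; suc; toℕ; fromℕ<; combine; remQuot; splitAt; _↑ˡ_; _↑ʳ_; _≟_)
open import Data.Fin.Properties
  using (any?; all?; toℕ<n; fromℕ<-toℕ; toℕ-fromℕ<; remQuot-combine; splitAt-↑ˡ; splitAt-↑ʳ)
open import Data.Fin.Subset using (Subset; _∈_; ⊥)
open import Data.Fin.Subset.Properties using (_∈?_; ⊆-antisym)
open import Data.Vec using (Vec; []; _∷_; lookup; tabulate; replicate)
open import Data.Vec.Properties using (lookup∘tabulate; tabulate∘lookup; tabulate-cong; []=⇒lookup; lookup⇒[]=)
open import Data.Bool using (Bool; true; false; T; if_then_else_)
open import Data.Bool.Properties using (T?)
open import Data.Maybe using (Maybe; just; nothing; fromMaybe)
open import Data.List using (List; [_]; map; filter; allFin; cartesianProductWith)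
open import Data.List.Extrema.Nat using (argmin; argmin-sel; f[argmin]≤v⁺; f[argmin]≤f[⊤])
import Data.List.Membership.Propositional as List
open import Data.List.Membership.Propositional using (lose)
open import Data.List.Membership.Propositional.Properties
  using (∈-allFin; ∈-map⁺; ∈-map⁻; ∈-filter⁺; ∈-filter⁻; ∈-cartesianProductWith⁺)
open import Data.List.Relation.Unary.Any using (here)
open import Data.Product using (Σ; ∃; ∃-syntax; _×_; _,_; proj₁; proj₂; uncurry)
open import Data.Sum using (_⊎_; inj₁; inj₂; [_,_]′)
open import Data.Empty using (⊥-elim)
open import Relation.Nullary using (¬_; Dec; does; yes; no)
open import Relation.Nullary.Decidable using (dec-true; dec-false; _×-dec_; _⊎-dec_; _→-dec_)
open import Relation.Binary.PropositionalEquality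
  using (_≡_; _≢_; _≗_; refl; sym; trans; cong; cong₂; subst; subst₂; module ≡-Reasoning)
open import Function.Bundles using (_⇔_; mk⇔; Equivalence)

open +-*-Solver using (solve; _:=_; _:+_; _:*_; con)

least-witness : {P : ℕ → Set} → (∀ l → Dec (P l)) → ∀ l → P l →
                ∃[ d ] (P d × (∀ d′ → d′ < d → ¬ P d′))
least-witness {P} P? = <-rec _ λ l rec pl → search l rec pl (anyUpTo? P? l)
  where
  search : ∀ l → (∀ {l′} → l′ < l → P l′ → ∃[ d ] (P d × (∀ d′ → d′ < d → ¬ P d′))) → P l →
           Dec (∃ λ l′ → l′ < l × P l′) → ∃[ d ] (P d × (∀ d′ → d′ < d → ¬ P d′))
  search l rec pl (yes (l′ , l′<l , pl′)) = rec l′<l pl′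
  search l rec pl (no none) = l , pl , λ d′ d′<l pd′ → none (d′ , d′<l , pd′)

Adjacency : ℕ → Set
Adjacency n = Vec (Subset n) n

data AdjWalk {n} (A : Adjacency n) : Fin n → Fin n → ℕ → Set where
  [] : ∀ {u} → AdjWalk A u u 0
  _∷_ : ∀ {u w v l} → w ∈ lookup A u → AdjWalk A w v l → AdjWalk A u v (suc l)

AdjWalk-0 : ∀ {n} {A : Adjacency n} {u v} → AdjWalk A u v 0 → v ≡ u
AdjWalk-0 [] = refl

record Entry (n : ℕ) : Set where
  constructor entry
  field
    dist : ℕ
    row  : Subset n
open Entry public

Row : ℕ → Set
Row n = Fin n → Entry n

-- T v x is what node v claims about node x: its distance from v and its neighbourhood.
Table : ℕ → Set
Table n = Fin n → Row n

module Relaxation {n : ℕ} (D : ℕ) where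

  record Accurate (s : ℕ) (A : Adjacency n) (T : Table n) : Set where
    field
      sound    : ∀ v x → dist (T v x) ≤ s → dist (T v x) < D → row (T v x) ≡ lookup A x
      complete : ∀ v x l → l ≤ s → l < D → AdjWalk A v x l → dist (T v x) ≤ l
  open Accurate public

  Accurate-≗ : ∀ {s A T T′} → (∀ v → T v ≗ T′ v) → Accurate s A T → Accurate s A T′
  Accurate-≗ {s} {A} eq acc = record
    { sound    = λ v x → subst (λ e → dist e ≤ s → dist e < D → row e ≡ lookup A x) (eq v x) (sound acc v x)
    ; complete = λ v x l l≤s l<D w → subst (λ e → dist e ≤ l) (eq v x) (complete acc v x l l≤s l<D w)
    }

  Accurate-mono : ∀ {s s′ A T} → s′ ≤ s → Accurate s A T → Accurate s′ A T
  Accurate-mono s′≤s acc = record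
    { sound    = λ v x d≤s′ → sound acc v x (≤-trans d≤s′ s′≤s)
    ; complete = λ v x l l≤s′ → complete acc v x l (≤-trans l≤s′ s′≤s)
    }

  withOwnRow : Subset n → Fin n → Row n → Row n
  withOwnRow nbv v R x with x ≟ v
  ... | yes _ = entry 0 nbv
  ... | no _  = R x

  ownRows : Adjacency n → Table n → Table n
  ownRows A T v = withOwnRow (lookup A v) v (T v)

  ownRows-accurate : ∀ {s A T} →
    (∀ v x → x ≢ v → dist (T v x) ≤ s → dist (T v x) < D → row (T v x) ≡ lookup A x) →
    (∀ v x l → x ≢ v → l ≤ s → l < D → AdjWalk A v x l → dist (T v x) ≤ l) →
    Accurate s A (ownRows A T)
  ownRows-accurate {s} {A} {T} snd cmp = record { sound = snd′ ; complete = cmp′ }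
    where
    snd′ : ∀ v x → dist (ownRows A T v x) ≤ s → dist (ownRows A T v x) < D →
           row (ownRows A T v x) ≡ lookup A x
    snd′ v x with x ≟ v
    ... | yes refl = λ _ _ → refl
    ... | no x≢v   = snd v x x≢v
    cmp′ : ∀ v x l → l ≤ s → l < D → AdjWalk A v x l → dist (ownRows A T v x) ≤ l
    cmp′ v x l with x ≟ v
    ... | yes refl = λ _ _ _ → z≤n
    ... | no x≢v   = cmp v x l x≢v

  ownRows-accurate₀ : ∀ {A T} → (∀ v x → 1 ≤ dist (T v x)) → Accurate 0 A (ownRows A T)
  ownRows-accurate₀ pos = ownRows-accurate
    (λ v x _ d≤0 _ → ⊥-elim (<-irrefl refl (≤-trans (pos v x) d≤0)))
    (λ { v x .0 x≢v z≤n _ w → ⊥-elim (x≢v (AdjWalk-0 w)) })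

  hop : Entry n → Entry n
  hop e = entry (suc (dist e)) (row e)

  -- E u x is what the current node has learnt from its neighbour u about x.
  candidates : Subset n → (Fin n → Row n) → Fin n → List (Entry n)
  candidates nbv E x = map (λ u → hop (E u x)) (filter (_∈? nbv) (allFin n))

  relax : Subset n → (Fin n → Row n) → Row n
  relax nbv E x = argmin dist (entry D ⊥) (candidates nbv E x)

  relax-≤ : ∀ nbv E x → dist (relax nbv E x) ≤ D
  relax-≤ nbv E x = f[argmin]≤f[⊤] {f = dist} (entry D ⊥) (candidates nbv E x)

  relax-optimal : ∀ {nbv} E x {u} → u ∈ nbv → dist (relax nbv E x) ≤ suc (dist (E u x))
  relax-optimal E x {u} u∈nbv = f[argmin]≤v⁺ {f = dist} (entry D ⊥) (candidates _ E x)
    (inj₂ (lose (∈-map⁺ (λ u → hop (E u x)) (∈-filter⁺ (_∈? _) (∈-allFin u) u∈nbv)) ≤-refl))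

  relax-witness : ∀ nbv E x →
    relax nbv E x ≡ entry D ⊥ ⊎ ∃[ u ] (u ∈ nbv × relax nbv E x ≡ hop (E u x))
  relax-witness nbv E x with argmin-sel dist (entry D ⊥) (candidates nbv E x)
  ... | inj₁ eq  = inj₁ eq
  ... | inj₂ mem with ∈-map⁻ (λ u → hop (E u x)) mem
  ...   | u , u∈ , eq = inj₂ (u , proj₂ (∈-filter⁻ (_∈? nbv) {xs = allFin n} u∈) , eq)

  relax-positive : ∀ nbv E x → 1 ≤ D → 1 ≤ dist (relax nbv E x)
  relax-positive nbv E x 1≤D with relax-witness nbv E x
  ... | inj₁ eq           = subst (λ e → 1 ≤ dist e) (sym eq) 1≤D
  ... | inj₂ (_ , _ , eq) = subst (λ e → 1 ≤ dist e) (sym eq) (s≤s z≤n)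

  relax-accurate : ∀ {s A T} (E : Fin n → Fin n → Row n) → Accurate s A T →
    (∀ v u → u ∈ lookup A v → E v u ≗ T u) →
    Accurate (suc s) A (ownRows A (λ v → relax (lookup A v) (E v)))
  relax-accurate {s} {A} {T} E acc heard = ownRows-accurate snd cmp
    where
    R : Table n
    R v = relax (lookup A v) (E v)
    snd : ∀ v x → x ≢ v → dist (R v x) ≤ suc s → dist (R v x) < D → row (R v x) ≡ lookup A x
    snd v x _ d≤1+s d<D with relax-witness (lookup A v) (E v) x
    ... | inj₁ eq = ⊥-elim (<-irrefl (cong dist eq) d<D)
    ... | inj₂ (u , u∈ , eq) = trans (cong row hopT) (sound acc u x
            (s≤s⁻¹ (subst (λ e → dist e ≤ suc s) hopT d≤1+s))
            (<-trans (n<1+n _) (subst (λ e → dist e < D) hopT d<D)))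
      where
      hopT : R v x ≡ hop (T u x)
      hopT = trans eq (cong hop (heard v u u∈ x))
    cmp : ∀ v x l → x ≢ v → l ≤ suc s → l < D → AdjWalk A v x l → dist (R v x) ≤ l
    cmp v x .0 x≢v _ _ [] = ⊥-elim (x≢v refl)
    cmp v x (suc l) _ l<1+s l<D (_∷_ {w = u} u∈ w) =
      ≤-trans (relax-optimal (E v) x u∈)
              (s≤s (subst (_≤ l) (sym (cong dist (heard v u u∈ x)))
                      (complete acc u x l (s≤s⁻¹ l<1+s) (<-trans (n<1+n l) l<D) w)))

module Chunks (B : ℕ) .{{_ : NonZero B}} where

  bitAt : ∀ {M} → (Fin M → Bool) → ℕ → Bool
  bitAt {M} f j with j <? M
  ... | yes j<M = f (fromℕ< j<M)
  ... | no _    = false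

  bitAt-toℕ : ∀ {M} (f : Fin M → Bool) i → bitAt f (toℕ i) ≡ f i
  bitAt-toℕ {M} f i with toℕ i <? M
  ... | yes i<M = cong f (fromℕ<-toℕ i i<M)
  ... | no i≮M  = ⊥-elim (i≮M (toℕ<n i))

  chunk : ∀ {M} → (Fin M → Bool) → ℕ → Vec Bool B
  chunk f p = tabulate (λ q → bitAt f (p * B + toℕ q))

  readBit : (ℕ → Vec Bool B) → ℕ → Bool
  readBit chunks j = lookup (chunks (j / B)) (fromℕ< (m%n<n j B))

  readBit-chunks : ∀ {M m} (f : Fin M → Bool) (chunks : ℕ → Vec Bool B) → M ≤ m * B →
    (∀ p → p < m → chunks p ≡ chunk f p) → ∀ i → readBit chunks (toℕ i) ≡ f i
  readBit-chunks f chunks M≤mB received i = begin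
    lookup (chunks (j / B)) r             ≡⟨ cong (λ c → lookup c r) (received (j / B) (m<n*o⇒m/o<n j<mB)) ⟩
    lookup (chunk f (j / B)) r            ≡⟨ lookup∘tabulate _ r ⟩
    bitAt f (j / B * B + toℕ r)           ≡⟨ cong (λ z → bitAt f (j / B * B + z)) (toℕ-fromℕ< (m%n<n j B)) ⟩
    bitAt f (j / B * B + j % B)           ≡⟨ cong (bitAt f) (trans (+-comm (j / B * B) (j % B)) (sym (m≡m%n+[m/n]*n j B))) ⟩
    bitAt f j                             ≡⟨ bitAt-toℕ f i ⟩
    f i                                   ∎
    where
    open ≡-Reasoning
    j = toℕ i
    r = fromℕ< (m%n<n j B)
    j<mB = ≤-trans (toℕ<n i) M≤mB

-- An entry with distance at most D is sent as a one-hot distance on D+1 bits followed by its row.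
module RowCode (n D : ℕ) where

  entryBits : ℕ
  entryBits = suc D + n

  rowBits : ℕ
  rowBits = n * entryBits

  encodeEntry : Entry n → Fin entryBits → Bool
  encodeEntry e i = [ (λ d → toℕ d ≡ᵇ dist e) , lookup (row e) ]′ (splitAt (suc D) i)

  encodeRow : Row n → Fin rowBits → Bool
  encodeRow R j = uncurry (λ x i → encodeEntry (R x) i) (remQuot {n} entryBits j)

  decodeDist : (Fin (suc D) → Bool) → ℕ
  decodeDist bits with any? (λ d → T? (bits d))
  ... | yes (d , _) = toℕ d
  ... | no _        = 0

  decodeRow : (Fin rowBits → Bool) → Row n
  decodeRow b x = entry (decodeDist (λ d → b (combine x (d ↑ˡ n))))
                        (tabulate (λ y → b (combine x (suc D ↑ʳ y))))

  decodeDist-oneHot : ∀ {d} bits → (∀ i → bits i ≡ (toℕ i ≡ᵇ d)) → d ≤ D → decodeDist bits ≡ d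
  decodeDist-oneHot {d} bits oneHot d≤D with any? (λ i → T? (bits i))
  ... | yes (i , set) = ≡ᵇ⇒≡ (toℕ i) d (subst T (oneHot i) set)
  ... | no none       = ⊥-elim (none (i , subst T (sym (oneHot i)) (≡⇒≡ᵇ (toℕ i) d (toℕ-fromℕ< (s≤s d≤D)))))
    where i = fromℕ< (s≤s d≤D)

  encodeRow-combine : ∀ R x i → encodeRow R (combine x i) ≡ encodeEntry (R x) i
  encodeRow-combine R x i = cong (uncurry (λ x i → encodeEntry (R x) i)) (remQuot-combine x i)

  encodeRow-dist : ∀ R x d → encodeRow R (combine x (d ↑ˡ n)) ≡ (toℕ d ≡ᵇ dist (R x))
  encodeRow-dist R x d = trans (encodeRow-combine R x _) (cong [ _ , _ ]′ (splitAt-↑ˡ (suc D) d n))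

  encodeRow-row : ∀ R x y → encodeRow R (combine x (suc D ↑ʳ y)) ≡ lookup (row (R x)) y
  encodeRow-row R x y = trans (encodeRow-combine R x _) (cong [ _ , _ ]′ (splitAt-↑ʳ (suc D) n y))

  decodeRow-encodeRow : ∀ (b : Fin rowBits → Bool) R → b ≗ encodeRow R → (∀ x → dist (R x) ≤ D) →
                        decodeRow b ≗ R
  decodeRow-encodeRow b R b≗ bounded x = cong₂ entry
    (decodeDist-oneHot _ (λ d → trans (b≗ _) (encodeRow-dist R x d)) (bounded x))
    (trans (tabulate-cong (λ y → trans (b≗ _) (encodeRow-row R x y))) (tabulate∘lookup (row (R x))))

settled-back : ∀ {n r} {Gs : ℕ → DGraph n} {t} → Settled r Gs t →
               ∀ d → d < r → d ≤ t → DGraph.adj (Gs (t ∸ d)) ≡ DGraph.adj (Gs t)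
settled-back set zero _ _ = refl
settled-back {Gs = Gs} set (suc d) d<r d<t =
  trans (proj₂ (set d d<r d<t)) (settled-back {Gs = Gs} set d (<-trans (n<1+n d) d<r) (<⇒≤ d<t))

settled-window : ∀ {n r} {Gs : ℕ → DGraph n} {t} → Settled r Gs t →
                 ∀ τ → τ ≤ t → t < τ + r → DGraph.adj (Gs τ) ≡ DGraph.adj (Gs t)
settled-window {r = r} {Gs} {t} set τ τ≤t t<τ+r =
  subst (λ z → DGraph.adj (Gs z) ≡ DGraph.adj (Gs t)) (m∸[m∸n]≡n τ≤t)
    (settled-back {Gs = Gs} set (t ∸ τ) t∸τ<r (m∸n≤m t τ))
  where
  t∸τ<r : t ∸ τ < r
  t∸τ<r = subst (t ∸ τ <_) (m+n∸n≡m r τ) (∸-monoˡ-< (subst (t <_) (+-comm τ r) t<τ+r) τ≤t)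

-- Nodes work in epochs of m rounds; in each epoch a node streams its current row of
-- distance-tagged neighbourhoods in m chunks of B bits, and at the end of the epoch
-- it relaxes its row over what it has received.
module Protocol {n : ℕ} (K m′ B′ : ℕ) (output : Fin n → Row n → List (Sub n)) where

  D m B : ℕ
  D = suc K
  m = suc m′
  B = suc B′

  open Relaxation {n} D
  open RowCode n D
  open Chunks B

  Inbox : Set
  Inbox = Fin n → ℕ → Vec Bool B

  record NodeState : Set where
    constructor nodeState
    field
      clock : ℕ
      me    : Fin n
      nbhd  : Subset n
      table : Row n
      inbox : Inbox
  open NodeState

  slot : NodeState → ℕ
  slot s = clock s % m

  view : Subset n → NodeState → Row n
  view nbv s = withOwnRow nbv (me s) (table s)

  store : ℕ → (Fin n → Maybe (Vec Bool B)) → Inbox → Inbox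
  store p msgs ib u q = if does (q ≟ℕ p) then fromMaybe (ib u q) (msgs u) else ib u q

  decodeInbox : Inbox → Fin n → Row n
  decodeInbox ib u = decodeRow (λ j → readBit (ib u) (toℕ j))

  nextTable : Bool → Subset n → Inbox → Row n → Row n
  nextTable true  nbv ib R = relax nbv (decodeInbox ib)
  nextTable false nbv ib R = R

  receive : NodeState → Subset n → (Fin n → Maybe (Vec Bool B)) → NodeState
  receive s nbv msgs = nodeState (suc (clock s)) (me s) nbv
    (nextTable (does (suc (slot s) ≟ℕ m)) nbv (store (slot s) msgs (inbox s)) (table s))
    (store (slot s) msgs (inbox s))

  -- Initially every row of G⁰ is known exactly, and 1 is a lower bound on the distance to any other node.
  algorithm : Algorithm n B
  algorithm = record
    { State = NodeState
    ; init  = λ v G₀ → nodeState 0 v (nbrs G₀ v) (λ x → entry 1 (nbrs G₀ x)) (λ _ _ → replicate B false)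
    ; send  = λ s nbv _ → chunk (encodeRow (view nbv s)) (slot s)
    ; recv  = receive
    ; out   = λ s → output (me s) (view (nbhd s) s)
    }

  InRange : Entry n → Set
  InRange e = 1 ≤ dist e × dist e ≤ D

  nextTable-inRange : ∀ b nbv ib R → (∀ x → InRange (R x)) → ∀ x → InRange (nextTable b nbv ib R x)
  nextTable-inRange true  nbv ib R _ x = relax-positive nbv (decodeInbox ib) x (s≤s z≤n) , relax-≤ nbv (decodeInbox ib) x
  nextTable-inRange false nbv ib R inR x = inR x

  receive-idle : ∀ s nbv msgs → suc (slot s) ≢ m → table (receive s nbv msgs) ≡ table s
  receive-idle s nbv msgs ne rewrite dec-false (suc (slot s) ≟ℕ m) ne = refl

  receive-epochEnd : ∀ s nbv msgs → suc (slot s) ≡ m →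
                     table (receive s nbv msgs) ≡ relax nbv (decodeInbox (inbox (receive s nbv msgs)))
  receive-epochEnd s nbv msgs eq rewrite dec-true (suc (slot s) ≟ℕ m) eq = refl

  store-current : ∀ p msgs ib u {c} → msgs u ≡ just c → store p msgs ib u p ≡ c
  store-current p msgs ib u eq rewrite dec-true (p ≟ℕ p) refl | eq = refl

  store-other : ∀ p msgs ib u q → q ≢ p → store p msgs ib u q ≡ ib u q
  store-other p msgs ib u q ne rewrite dec-false (q ≟ℕ p) ne = refl

  epoch-slot : ∀ e p → p < m → (p + e * m) % m ≡ p
  epoch-slot e p p<m = trans ([m+kn]%n≡m%n p e m) (m<n⇒m%n≡m p<m)

  module Execution (Gs : ℕ → DGraph n) where

    run : ℕ → Fin n → NodeState
    run = state algorithm Gs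

    tableAt : ℕ → Table n
    tableAt t v = table (run t v)

    sentBy : ℕ → Fin n → Vec Bool B
    sentBy t u = chunk (encodeRow (view (nbrs (Gs (suc t)) u) (run t u))) (slot (run t u))

    incoming : ℕ → Fin n → Fin n → Maybe (Vec Bool B)
    incoming t v u = if does (u ∈? nbrs (Gs (suc t)) v) then just (sentBy t u) else nothing

    incoming-neighbour : ∀ t v u → u ∈ nbrs (Gs (suc t)) v → incoming t v u ≡ just (sentBy t u)
    incoming-neighbour t v u u∈ rewrite dec-true (u ∈? nbrs (Gs (suc t)) v) u∈ = refl

    clock-run : ∀ t v → clock (run t v) ≡ t
    clock-run zero    v = refl
    clock-run (suc t) v = cong suc (clock-run t v)

    me-run : ∀ t v → me (run t v) ≡ v
    me-run zero    v = refl
    me-run (suc t) v = me-run t v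

    nbhd-run : ∀ t v → nbhd (run t v) ≡ nbrs (Gs t) v
    nbhd-run zero    v = refl
    nbhd-run (suc t) v = refl

    output-run : ∀ t v → Algorithm.out algorithm (run t v) ≡ output v (ownRows (DGraph.adj (Gs t)) (tableAt t) v)
    output-run t v rewrite me-run t v | nbhd-run t v = refl

    table-inRange : ∀ t v x → InRange (tableAt t v x)
    table-inRange zero    v x = s≤s z≤n , s≤s z≤n
    table-inRange (suc t) v = nextTable-inRange (does (suc (slot s) ≟ℕ m)) (nbrs (Gs (suc t)) v)
                                (store (slot s) (incoming t v) (inbox s)) (table s) (table-inRange t v)
      where s = run t v

    slot-run : ∀ e p v → p < m → slot (run (p + e * m) v) ≡ p
    slot-run e p v p<m = trans (cong (_% m) (clock-run (p + e * m) v)) (epoch-slot e p p<m)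

    table-epoch : ∀ e p v → p < m → tableAt (p + e * m) v ≡ tableAt (e * m) v
    table-epoch e zero    v _   = refl
    table-epoch e (suc p) v 1+p<m =
      trans (receive-idle (run τ v) (nbrs (Gs (suc τ)) v) (incoming τ v) mid-epoch) (table-epoch e p v p<m)
      where
      τ = p + e * m
      p<m = <-trans (n<1+n p) 1+p<m
      mid-epoch : suc (slot (run τ v)) ≢ m
      mid-epoch eq = <⇒≢ 1+p<m (trans (cong suc (sym (slot-run e p v p<m))) eq)

    StableEpoch : ℕ → Adjacency n → Set
    StableEpoch e A = ∀ q → q < m → DGraph.adj (Gs (suc q + e * m)) ≡ A

    sent-in-epoch : ∀ e A p u → StableEpoch e A → p < m →
      sentBy (p + e * m) u ≡ chunk (encodeRow (ownRows A (tableAt (e * m)) u)) p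
    sent-in-epoch e A p u stable p<m
      rewrite me-run (p + e * m) u | table-epoch e p u p<m | slot-run e p u p<m | stable p p<m = refl

    inbox-epoch : ∀ e A → StableEpoch e A → ∀ p → p ≤ m → ∀ v u → u ∈ lookup A v → ∀ q → q < p →
      inbox (run (p + e * m) v) u q ≡ chunk (encodeRow (ownRows A (tableAt (e * m)) u)) q
    inbox-epoch e A stable (suc p) 1+p≤m v u u∈ q q<1+p with q ≟ℕ p
    ... | yes refl = trans
            (cong (λ z → store z (incoming τ v) (inbox (run τ v)) u p) (slot-run e p v 1+p≤m))
            (trans (store-current p (incoming τ v) (inbox (run τ v)) u
                      (incoming-neighbour τ v u (subst (λ A′ → u ∈ lookup A′ v) (sym (stable p 1+p≤m)) u∈)))
                   (sent-in-epoch e A p u stable 1+p≤m))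
      where τ = p + e * m
    ... | no q≢p = trans
            (store-other _ (incoming τ v) (inbox (run τ v)) u q (λ eq → q≢p (trans eq (slot-run e p v 1+p≤m))))
            (inbox-epoch e A stable p (<⇒≤ 1+p≤m) v u u∈ q (≤∧≢⇒< (s≤s⁻¹ q<1+p) q≢p))
      where τ = p + e * m

    ownRows-≤ : ∀ A t u x → dist (ownRows A (tableAt t) u x) ≤ D
    ownRows-≤ A t u x with x ≟ u
    ... | yes _ = z≤n
    ... | no _  = proj₂ (table-inRange t u x)

    table-epochEnd : ∀ e A v → StableEpoch e A →
      tableAt (m + e * m) v ≡ relax (lookup A v) (decodeInbox (inbox (run (m + e * m) v)))
    table-epochEnd e A v stable =
      trans (receive-epochEnd (run τ v) (nbrs (Gs (m + e * m)) v) (incoming τ v) (cong suc (slot-run e m′ v ≤-refl)))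
            (cong (λ A′ → relax (lookup A′ v) (decodeInbox (inbox (run (m + e * m) v)))) (stable m′ ≤-refl))
      where τ = m′ + e * m

    initial-accurate : ∀ s → Accurate s (DGraph.adj (Gs 0)) (ownRows (DGraph.adj (Gs 0)) (tableAt 0))
    initial-accurate s = ownRows-accurate (λ _ _ _ _ _ → refl) λ where
      v x zero    x≢v _ _ w → ⊥-elim (x≢v (AdjWalk-0 w))
      v x (suc l) _   _ _ _ → s≤s z≤n

    module _ (fits : rowBits ≤ m * B) where

      epoch-accurate : ∀ e s A → StableEpoch e A → Accurate s A (ownRows A (tableAt (e * m))) →
                       Accurate (suc s) A (ownRows A (tableAt (m + e * m)))
      epoch-accurate e s A stable acc =
        Accurate-≗ (λ v x → cong (λ R → withOwnRow (lookup A v) v R x) (sym (table-epochEnd e A v stable)))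
          (relax-accurate (λ v → decodeInbox (inbox (run (m + e * m) v))) acc heard)
        where
        heard : ∀ v u → u ∈ lookup A v → decodeInbox (inbox (run (m + e * m) v)) u ≗ ownRows A (tableAt (e * m)) u
        heard v u u∈ = decodeRow-encodeRow _ (ownRows A (tableAt (e * m)) u)
          (readBit-chunks _ (inbox (run (m + e * m) v) u) fits (inbox-epoch e A stable m ≤-refl v u u∈))
          (ownRows-≤ A (e * m) u)

      epochs-accurate : ∀ j e s A → (∀ i → i < j → StableEpoch (i + e) A) →
        Accurate s A (ownRows A (tableAt (e * m))) → Accurate (j + s) A (ownRows A (tableAt ((j + e) * m)))
      epochs-accurate zero    e s A stable acc = acc
      epochs-accurate (suc j) e s A stable acc =
        epoch-accurate (j + e) (j + s) A (stable j (n<1+n j))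
          (epochs-accurate j e s A (λ i i<j → stable i (<-trans i<j (n<1+n j))) acc)

      epochs-stable : ∀ {A} e j → (∀ τ → e * m < τ → τ ≤ (j + e) * m → DGraph.adj (Gs τ) ≡ A) →
                      ∀ i → i < j → StableEpoch (i + e) A
      epochs-stable e j calm i i<j q′ q′<m = calm (suc q′ + (i + e) * m)
        (s≤s (≤-trans (*-monoˡ-≤ m (m≤n+m e i)) (m≤n+m _ q′)))
        (≤-trans (+-monoˡ-≤ ((i + e) * m) q′<m) (*-monoˡ-≤ m (+-monoˡ-≤ e i<j)))

      recent-epochs-accurate : ∀ {A} e → (∀ τ → e * m < τ → τ ≤ (K + e) * m → DGraph.adj (Gs τ) ≡ A) →
                               Accurate K A (ownRows A (tableAt ((K + e) * m)))
      recent-epochs-accurate {A} e calm = Accurate-mono (m≤m+n K 0)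
        (epochs-accurate K e 0 A (epochs-stable e K calm) (ownRows-accurate₀ (λ v x → proj₁ (table-inRange (e * m) v x))))

      early-epochs-accurate : ∀ {A} j → (∀ τ → τ ≤ j * m → DGraph.adj (Gs τ) ≡ A) →
                              Accurate K A (ownRows A (tableAt (j * m)))
      early-epochs-accurate {A} j calm = Accurate-mono (m≤n+m K j)
        (subst (λ z → Accurate (j + K) A (ownRows A (tableAt (z * m)))) (+-identityʳ j)
          (epochs-accurate j 0 K A (epochs-stable 0 j λ τ _ τ≤ → calm τ (subst (λ z → τ ≤ z * m) (+-identityʳ j) τ≤))
            (subst (λ A′ → Accurate K A′ (ownRows A′ (tableAt 0))) (calm 0 z≤n) (initial-accurate K))))

      -- With D m ≤ r + 1 the last K epochs before t lie in the change-free window; if t is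
      -- earlier than that, nothing has changed since round 0, when every node knew the whole graph.
      settled-accurate : ∀ r t → D * m ≤ suc r → Settled r Gs t →
        Accurate K (DGraph.adj (Gs t)) (ownRows (DGraph.adj (Gs t)) (tableAt t))
      settled-accurate r t Dm≤1+r settled = Accurate-≗ now (at-epoch-start (K ≤? q))
        where
        A = DGraph.adj (Gs t)
        q = t / m
        t≡ : t ≡ t % m + q * m
        t≡ = m≡m%n+[m/n]*n t m
        qm≤t : q * m ≤ t
        qm≤t = subst (q * m ≤_) (sym t≡) (m≤n+m (q * m) (t % m))
        t<[1+q]m : t < suc q * m
        t<[1+q]m = subst (_< suc q * m) (sym t≡) (+-monoˡ-< (q * m) (m%n<n t m))
        calm : ∀ τ → τ ≤ q * m → t < τ + r → DGraph.adj (Gs τ) ≡ A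
        calm τ τ≤qm = settled-window {Gs = Gs} settled τ (≤-trans τ≤qm qm≤t)
        now : ∀ v x → ownRows A (tableAt (q * m)) v x ≡ ownRows A (tableAt t) v x
        now v x = cong (λ R → withOwnRow (lookup A v) v R x)
          (trans (sym (table-epoch q (t % m) v (m%n<n t m))) (cong (λ z → tableAt z v) (sym t≡)))
        at-epoch-start : Dec (K ≤ q) → Accurate K A (ownRows A (tableAt (q * m)))
        at-epoch-start (yes K≤q) = subst (λ z → Accurate K A (ownRows A (tableAt (z * m)))) K+e₀≡q
            (recent-epochs-accurate e₀ λ τ e₀m<τ τ≤ → calm τ (subst (λ z → τ ≤ z * m) K+e₀≡q τ≤) (t<τ+r τ e₀m<τ))
          where
          e₀ = q ∸ K
          K+e₀≡q : K + e₀ ≡ q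
          K+e₀≡q = m+[n∸m]≡n K≤q
          t<τ+r : ∀ τ → e₀ * m < τ → t < τ + r
          t<τ+r τ e₀m<τ = begin-strict
            t                  <⟨ t<[1+q]m ⟩
            suc q * m          ≡⟨ cong (λ z → suc z * m) (sym K+e₀≡q) ⟩
            (D + e₀) * m       ≡⟨ *-distribʳ-+ m D e₀ ⟩
            D * m + e₀ * m     ≤⟨ +-monoˡ-≤ (e₀ * m) Dm≤1+r ⟩
            suc (r + e₀ * m)   ≡⟨ cong suc (+-comm r (e₀ * m)) ⟩
            suc (e₀ * m) + r   ≤⟨ +-monoˡ-≤ r e₀m<τ ⟩
            τ + r              ∎
            where open ≤-Reasoning
        at-epoch-start (no K≰q) = early-epochs-accurate q λ τ τ≤ → calm τ τ≤ (<-≤-trans t<r (m≤n+m r τ))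
          where
          t<r : t < r
          t<r = begin-strict
            t            <⟨ t<[1+q]m ⟩
            suc q * m    ≤⟨ *-monoˡ-≤ m (≰⇒> K≰q) ⟩
            K * m        ≤⟨ m≤n+m (K * m) m′ ⟩
            m′ + K * m   ≤⟨ s≤s⁻¹ Dm≤1+r ⟩
            r            ∎
            where open ≤-Reasoning

  solves : ∀ {k} (H : SimpleGraph k) τ r → rowBits ≤ m * B → D * m ≤ suc r →
    (∀ G T v → Accurate K (DGraph.adj G) T → MemListCorrect H G v (output v (T v))) →
    SolvesMemList H τ r algorithm
  solves H τ r fits Dm≤1+r output-correct Gs _ _ t settled v =
    subst (MemListCorrect H (Gs t) v) (sym (output-run t v))
      (output-correct (Gs t) _ v (settled-accurate fits r t Dm≤1+r settled))
    where open Execution Gs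

subsetOf : ∀ {n} {P : Fin n → Set} → (∀ x → Dec (P x)) → Subset n
subsetOf P? = tabulate (λ x → does (P? x))

∈-subsetOf⁺ : ∀ {n} {P : Fin n → Set} (P? : ∀ x → Dec (P x)) {x} → P x → x ∈ subsetOf P?
∈-subsetOf⁺ P? {x} px = lookup⇒[]= x _ (trans (lookup∘tabulate _ x) (dec-true (P? x) px))

∈-subsetOf⁻ : ∀ {n} {P : Fin n → Set} (P? : ∀ x → Dec (P x)) {x} → x ∈ subsetOf P? → P x
∈-subsetOf⁻ P? {x} x∈ with P? x | trans (sym (lookup∘tabulate (λ x → does (P? x)) x)) ([]=⇒lookup x∈)
... | yes px | _ = px
... | no _   | ()

tuples : ∀ n j → List (Vec (Fin n) j)
tuples n zero    = [ [] ]
tuples n (suc j) = cartesianProductWith _∷_ (allFin n) (tuples n j)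

∈-tuples : ∀ {n j} (w : Vec (Fin n) j) → w List.∈ tuples n j
∈-tuples []      = here refl
∈-tuples (x ∷ w) = ∈-cartesianProductWith⁺ _∷_ (∈-allFin x) (∈-tuples w)

Walk? : ∀ {k} (H : SimpleGraph k) u w l → Dec (Walk H u w l)
Walk? H u w zero with u ≟ w
... | yes refl = yes []
... | no u≢w   = no λ { [] → u≢w refl }
Walk? H u w (suc l) with any? (λ c → (c ∈? lookup (SimpleGraph.adj H) u) ×-dec Walk? H c w l)
... | yes (c , adj , walk) = yes (adj ∷ walk)
... | no none              = no λ { (adj ∷ walk) → none (_ , adj , walk) }

dist-exists : ∀ {k} (H : SimpleGraph k) → Connected H → ∀ a b → ∃[ d ] Dist H a b d
dist-exists H conn a b = least-witness (Walk? H a b) _ (proj₂ (conn a b))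

neighbour-exists : ∀ {k} (H : SimpleGraph k) → 2 ≤ k → Connected H → ∀ a → ∃[ c ] SAdj H a c
neighbour-exists H (s≤s (s≤s _)) conn a = first-step (proj₂ (conn a (other a))) (other-≢ a)
  where
  other : Fin _ → Fin _
  other zero    = suc zero
  other (suc _) = zero
  other-≢ : ∀ a → a ≢ other a
  other-≢ zero    ()
  other-≢ (suc _) ()
  first-step : ∀ {b l} → Walk H a b l → a ≢ b → ∃[ c ] SAdj H a c
  first-step []        a≢a = ⊥-elim (a≢a refl)
  first-step (adj ∷ _) _   = _ , adj

module Listing {n k : ℕ} (H : SimpleGraph k) (K : ℕ) where

  D : ℕ
  D = suc K

  open Relaxation {n} D

  SAdj? : ∀ a b → Dec (SAdj H a b)
  SAdj? a b = b ∈? lookup (SimpleGraph.adj H) a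

  hits? : ∀ (f : Vec (Fin n) k) x → Dec (∃[ a ] lookup f a ≡ x)
  hits? f x = any? λ a → lookup f a ≟ x

  hitsEdge? : ∀ (f : Vec (Fin n) k) x y → Dec (∃[ a ] ∃[ b ] (lookup f a ≡ x × lookup f b ≡ y × SAdj H a b))
  hitsEdge? f x y = any? λ a → any? λ b → (lookup f a ≟ x) ×-dec (lookup f b ≟ y) ×-dec SAdj? a b

  image : Vec (Fin n) k → Sub n
  image f = sub (subsetOf (hits? f)) (tabulate λ x → subsetOf (hitsEdge? f x))

  image-vertex⁺ : ∀ f a → lookup f a ∈ Sub.verts (image f)
  image-vertex⁺ f a = ∈-subsetOf⁺ (hits? f) (a , refl)

  image-vertex⁻ : ∀ f {x} → x ∈ Sub.verts (image f) → ∃[ a ] lookup f a ≡ x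
  image-vertex⁻ f = ∈-subsetOf⁻ (hits? f)

  image-edge⁺ : ∀ f {a b} → SAdj H a b → SEdge (image f) (lookup f a) (lookup f b)
  image-edge⁺ f {a} {b} ab = subst (lookup f b ∈_) (sym (lookup∘tabulate _ (lookup f a)))
                                   (∈-subsetOf⁺ (hitsEdge? f (lookup f a)) (a , b , refl , refl , ab))

  image-edge⁻ : ∀ f {x y} → SEdge (image f) x y →
                ∃[ a ] ∃[ b ] (lookup f a ≡ x × lookup f b ≡ y × SAdj H a b)
  image-edge⁻ f {x} xy = ∈-subsetOf⁻ (hitsEdge? f x) (subst (_ ∈_) (lookup∘tabulate _ x) xy)

  Known : Row n → Fin n → Fin n → Set
  Known R x y = (dist (R x) < D × y ∈ row (R x)) ⊎ (dist (R y) < D × x ∈ row (R y))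

  Candidate : Fin n → Row n → Vec (Fin n) k → Set
  Candidate v R f = (∀ a b → lookup f a ≡ lookup f b → a ≡ b) × (∃[ a ] lookup f a ≡ v) ×
                    (∀ a b → SAdj H a b → Known R (lookup f a) (lookup f b))

  candidate? : ∀ v R f → Dec (Candidate v R f)
  candidate? v R f =
    all? (λ a → all? λ b → (lookup f a ≟ lookup f b) →-dec (a ≟ b)) ×-dec
    any? (λ a → lookup f a ≟ v) ×-dec
    all? (λ a → all? λ b → SAdj? a b →-dec
      (((dist (R (lookup f a)) <? D) ×-dec (lookup f b ∈? row (R (lookup f a)))) ⊎-dec
       ((dist (R (lookup f b)) <? D) ×-dec (lookup f a ∈? row (R (lookup f b))))))

  memList : Fin n → Row n → List (Sub n)
  memList v R = map image (filter (candidate? v R) (tuples n k))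

  module Correctness (k≥2 : 2 ≤ k) (conn : Connected H) (diam : TildeDiam H D)
                     (G : DGraph n) (T : Table n) (acc : Accurate K (DGraph.adj G) T) (v : Fin n) where

    R : Row n
    R = T v

    trusted-row : ∀ x → dist (R x) < D → row (R x) ≡ nbrs G x
    trusted-row x d<D = sound acc v x (s≤s⁻¹ d<D) d<D

    known⇒adj : ∀ {x y} → Known R x y → Adj G x y
    known⇒adj {x} {y} (inj₁ (d<D , y∈)) = subst (y ∈_) (trusted-row x d<D) y∈
    known⇒adj {x} {y} (inj₂ (d<D , x∈)) = DGraph.sym G y x (subst (x ∈_) (trusted-row y d<D) x∈)

    module _ (f : Fin k → Fin n) (a₀ : Fin k) (f[a₀]≡v : f a₀ ≡ v)
             (f-adj : ∀ a b → SAdj H a b → Adj G (f a) (f b)) where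

      walk-image : ∀ {a b l} → Walk H a b l → AdjWalk (DGraph.adj G) (f a) (f b) l
      walk-image []         = []
      walk-image (ab ∷ walk) = f-adj _ _ ab ∷ walk-image walk

      trusted-endpoint : ∀ {a b d} → Dist H a₀ a d → d < D → SAdj H a b →
                         dist (R (f a)) < D × f b ∈ row (R (f a))
      trusted-endpoint {a} {b} {d} (walk , _) d<D ab = d′<D , subst (f b ∈_) (sym (trusted-row (f a) d′<D)) (f-adj a b ab)
        where
        walk-from-v : AdjWalk (DGraph.adj G) v (f a) d
        walk-from-v = subst (λ z → AdjWalk _ z (f a) d) f[a₀]≡v (walk-image walk)
        d′<D : dist (R (f a)) < D
        d′<D = ≤-<-trans (complete acc v (f a) d (s≤s⁻¹ d<D) d<D walk-from-v) d<D

      -- Every edge of H is within node-edge distance D of a₀, so one endpoint is at distance < D.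
      embedding-known : ∀ a b → SAdj H a b → Known R (f a) (f b)
      embedding-known a b ab with dist-exists H conn a₀ a | dist-exists H conn a₀ b
      ... | da , Da | db , Db with proj₁ diam a₀ a b _ (ab , da , db , Da , Db , refl) | da ≤? db
      ...   | ≤D | yes da≤db = inj₁ (trusted-endpoint Da (subst (_< D) (m≤n⇒m⊓n≡m da≤db) ≤D) ab)
      ...   | ≤D | no da≰db  = inj₂ (trusted-endpoint Db (subst (_< D) (m≥n⇒m⊓n≡n (<⇒≤ (≰⇒> da≰db))) ≤D)
                                                      (SimpleGraph.sym H a b ab))

    candidate-sound : ∀ f → Candidate v R f → IsSubgraphOf (image f) G × v ∈ Sub.verts (image f) × IsoTo (image f) H
    candidate-sound f (inj , (a₀ , f[a₀]≡v) , known) =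
      (present , edge-sym , edge-irrefl , edge-in-G) ,
      subst (_∈ Sub.verts (image f)) f[a₀]≡v (image-vertex⁺ f a₀) ,
      (lookup f , inj _ _ , image-vertex⁺ f , (λ x → image-vertex⁻ f) , iso)
      where
      present : ∀ x → x ∈ Sub.verts (image f) → Present G x
      present x x∈ with image-vertex⁻ f x∈
      ... | a , refl with neighbour-exists H k≥2 conn a
      ...   | c , ac = DGraph.closed G _ _ (known⇒adj (known a c ac))
      edge-sym : ∀ x y → SEdge (image f) x y → SEdge (image f) y x
      edge-sym x y xy with image-edge⁻ f xy
      ... | a , b , refl , refl , ab = image-edge⁺ f (SimpleGraph.sym H a b ab)
      edge-irrefl : ∀ x → ¬ SEdge (image f) x x
      edge-irrefl x xx with image-edge⁻ f xx
      ... | a , b , fa≡x , fb≡x , ab with inj a b (trans fa≡x (sym fb≡x))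
      ...   | refl = SimpleGraph.irrefl H a ab
      edge-in-G : ∀ x y → SEdge (image f) x y → x ∈ Sub.verts (image f) × y ∈ Sub.verts (image f) × Adj G x y
      edge-in-G x y xy with image-edge⁻ f xy
      ... | a , b , refl , refl , ab = image-vertex⁺ f a , image-vertex⁺ f b , known⇒adj (known a b ab)
      iso : ∀ a b → SAdj H a b ⇔ SEdge (image f) (lookup f a) (lookup f b)
      iso a b = mk⇔ (image-edge⁺ f) λ fafb → let (a′ , b′ , fa′≡fa , fb′≡fb , a′b′) = image-edge⁻ f fafb
                                               in subst₂ (SAdj H) (inj a′ a fa′≡fa) (inj b′ b fb′≡fb) a′b′

    -- A copy of H through v is the image of any of its isomorphisms, and that isomorphism passes the test.
    copy-listed : ∀ S → IsSubgraphOf S G × v ∈ Sub.verts S × IsoTo S H → S List.∈ memList v R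
    copy-listed S ((_ , _ , _ , edge-in-G) , v∈S , (f , inj , f∈S , onto , iso)) =
      subst (List._∈ memList v R) (sym S≡image)
        (∈-map⁺ image (∈-filter⁺ (candidate? v R) (∈-tuples fv) candidate))
      where
      fv = tabulate f
      fv≡f : ∀ a → lookup fv a ≡ f a
      fv≡f = lookup∘tabulate f
      a₀ = proj₁ (onto v v∈S)
      f-adj : ∀ a b → SAdj H a b → Adj G (f a) (f b)
      f-adj a b ab = proj₂ (proj₂ (edge-in-G (f a) (f b) (Equivalence.to (iso a b) ab)))
      candidate : Candidate v R fv
      candidate = (λ a b eq → inj (trans (sym (fv≡f a)) (trans eq (fv≡f b)))) ,
                  (a₀ , trans (fv≡f a₀) (proj₂ (onto v v∈S))) ,
                  (λ a b ab → subst₂ (Known R) (sym (fv≡f a)) (sym (fv≡f b))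
                                (embedding-known f a₀ (proj₂ (onto v v∈S)) f-adj a b ab))
      to-image : ∀ {x} → x ∈ Sub.verts S → x ∈ Sub.verts (image fv)
      to-image x∈ = let (a , fa≡x) = onto _ x∈
                    in subst (_∈ Sub.verts (image fv)) (trans (fv≡f a) fa≡x) (image-vertex⁺ fv a)
      verts≡ : Sub.verts S ≡ Sub.verts (image fv)
      verts≡ = ⊆-antisym to-image
        λ x∈ → let (a , fv[a]≡x) = image-vertex⁻ fv x∈
               in subst (_∈ Sub.verts S) (trans (sym (fv≡f a)) fv[a]≡x) (f∈S a)
      edges≡ : Sub.edges S ≡ Sub.edges (image fv)
      edges≡ = trans (sym (tabulate∘lookup (Sub.edges S))) (trans (tabulate-cong λ x → ⊆-antisym
        (λ {y} xy → let (x∈ , y∈ , _) = edge-in-G x y xy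
                        (a , fa≡x) = onto x x∈
                        (b , fb≡y) = onto y y∈
                    in subst₂ (SEdge (image fv)) (trans (fv≡f a) fa≡x) (trans (fv≡f b) fb≡y)
                         (image-edge⁺ fv (Equivalence.from (iso a b) (subst₂ (SEdge S) (sym fa≡x) (sym fb≡y) xy))))
        (λ {y} xy → let (a , b , fv[a]≡x , fv[b]≡y , ab) = image-edge⁻ fv xy
                    in subst₂ (SEdge S) (trans (sym (fv≡f a)) fv[a]≡x) (trans (sym (fv≡f b)) fv[b]≡y)
                         (Equivalence.to (iso a b) ab)))
        (tabulate∘lookup (Sub.edges (image fv))))
      S≡image : S ≡ image fv
      S≡image = cong₂ sub verts≡ edges≡

    memList-correct : MemListCorrect H G v (memList v R)
    memList-correct S = mk⇔ listed-copy (copy-listed S)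
      where
      listed-copy : S List.∈ memList v R → IsSubgraphOf S G × v ∈ Sub.verts S × IsoTo S H
      listed-copy S∈ with ∈-map⁻ image S∈
      ... | f , f∈ , refl = candidate-sound f (proj₂ (∈-filter⁻ (candidate? v R) {xs = tuples n k} f∈))

≤-ceiling : ∀ M m .{{_ : NonZero m}} → M ≤ m * suc (M / m)
≤-ceiling M m = <⇒≤ (begin-strict
  M                    ≡⟨ m≡m%n+[m/n]*n M m ⟩
  M % m + M / m * m    <⟨ +-monoˡ-< (M / m * m) (m%n<n M m) ⟩
  suc (M / m) * m      ≡⟨ *-comm (suc (M / m)) m ⟩
  m * suc (M / m)      ∎)
  where open ≤-Reasoning

-- suc epochs = ⌊(r + 1)/(K + 1)⌋ is the epoch length.
module EpochLength {K r : ℕ} (K≤r : K ≤ r) where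

  epochs : ℕ
  epochs = (r ∸ K) / suc K

  epochs-fit : suc K * suc epochs ≤ suc r
  epochs-fit = begin
    suc K * suc epochs         ≡⟨ *-comm (suc K) (suc epochs) ⟩
    suc K + epochs * suc K     ≤⟨ +-monoʳ-≤ (suc K) (m/n*n≤m (r ∸ K) (suc K)) ⟩
    suc K + (r ∸ K)            ≡⟨ cong suc (m+[n∸m]≡n K≤r) ⟩
    suc r                      ∎
    where open ≤-Reasoning

  window-bound : r ≤ 2 * (suc epochs * suc K)
  window-bound = begin
    r                 ≡⟨ sym (m+[n∸m]≡n K≤r) ⟩
    K + (r ∸ K)       ≤⟨ +-mono-≤ (≤-trans (n≤1+n K) (m≤m+n (suc K) (epochs * suc K))) (<⇒≤ r∸K<X) ⟩
    X + X             ≡⟨ cong (X +_) (sym (+-identityʳ X)) ⟩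
    2 * X             ∎
    where
    open ≤-Reasoning
    X = suc epochs * suc K
    r∸K<X : r ∸ K < X
    r∸K<X = subst (_< X) (sym (m≡m%n+[m/n]*n (r ∸ K) (suc K))) (+-monoˡ-< (epochs * suc K) (m%n<n (r ∸ K) (suc K)))

n≤n*n : ∀ n → n ≤ n * n
n≤n*n zero    = z≤n
n≤n*n (suc n) = m≤m*n (suc n) (suc n)

bandwidth : ℕ → ℕ
bandwidth D = suc (2 * D * (2 + D))

bandwidth-bound : ∀ n r D m .{{_ : NonZero m}} → r ≤ 2 * (m * D) →
                  suc (n * (suc D + n) / m) * r ≤ bandwidth D * (n * n + r)
bandwidth-bound n r D m r≤2mD = begin
  suc X * r                               ≤⟨ +-monoʳ-≤ r (*-monoʳ-≤ X r≤2mD) ⟩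
  r + X * (2 * (m * D))                   ≡⟨ cong (r +_) (regroup X m D) ⟩
  r + 2 * D * (X * m)                     ≤⟨ +-monoʳ-≤ r (*-monoʳ-≤ (2 * D) (≤-trans (m/n*n≤m M m) M≤)) ⟩
  r + 2 * D * (n * n * (2 + D))           ≤⟨ m≤m+n _ (n * n + 2 * D * (2 + D) * r) ⟩
  r + 2 * D * (n * n * (2 + D)) + (n * n + 2 * D * (2 + D) * r)
                                          ≡⟨ expand r D (n * n) ⟩
  bandwidth D * (n * n + r)               ∎
  where
  open ≤-Reasoning
  M = n * (suc D + n)
  X = M / m
  regroup : ∀ x m d → x * (2 * (m * d)) ≡ 2 * d * (x * m)
  regroup = solve 3 (λ x m d → x :* (con 2 :* (m :* d)) := con 2 :* d :* (x :* m)) refl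
  expand : ∀ r d p → r + 2 * d * (p * (2 + d)) + (p + 2 * d * (2 + d) * r) ≡ bandwidth d * (p + r)
  expand = solve 3 (λ r d p → r :+ con 2 :* d :* (p :* (con 2 :+ d)) :+ (p :+ con 2 :* d :* (con 2 :+ d) :* r)
                              := (con 1 :+ con 2 :* d :* (con 2 :+ d)) :* (p :+ r)) refl
  M≤ : M ≤ n * n * (2 + D)
  M≤ = begin
    n * (suc D + n)           ≡⟨ *-distribˡ-+ n (suc D) n ⟩
    n * suc D + n * n         ≤⟨ +-monoˡ-≤ (n * n) (*-monoˡ-≤ (suc D) (n≤n*n n)) ⟩
    n * n * suc D + n * n     ≡⟨ solve 2 (λ p d → p :* (con 1 :+ d) :+ p := p :* (con 2 :+ d)) refl (n * n) D ⟩
    n * n * (2 + D)           ∎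

theorem5p2 : ∀ {k} (H : SimpleGraph k) → 3 ≤ k → Connected H →
  ∀ D → TildeDiam H D → (τ : ChangeType) →
  ∃[ c ] (∀ n r → D ∸ 1 ≤ r →
    ∃[ B ] (B * r ≤ c * (n * n + r) × Σ (Algorithm n B) (SolvesMemList H τ r)))
theorem5p2 H _ _ zero (_ , _ , _ , _ , _ , _ , _ , _ , _ , ()) τ
theorem5p2 {k} H k≥3 conn (suc K) diam τ = bandwidth (suc K) , solution
  where
  solution : ∀ n r → K ≤ r → ∃[ B ] (B * r ≤ bandwidth (suc K) * (n * n + r) × Σ (Algorithm n B) (SolvesMemList H τ r))
  solution n r K≤r =
    suc (rowBits / suc epochs) , bandwidth-bound n r (suc K) (suc epochs) window-bound ,
    algorithm , solves H τ r (≤-ceiling rowBits (suc epochs)) epochs-fit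
      (λ G T v acc → Listing.Correctness.memList-correct H K (≤-trans (n≤1+n 2) k≥3) conn diam G T acc v)
    where
    open EpochLength K≤r
    open RowCode n (suc K) using (rowBits)
    open Protocol {n} K epochs (rowBits / suc epochs) (Listing.memList H K) using (algorithm; solves)
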